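{- Let $\mathbf{L}=\langle L,\leq\rangle$ be a complete lattice, $M\subseteq L$, and $S$ an $L$-parameterization. Then $C_M$ is an $\mathbf{S}'$-closure operator, where $S'$ is the monoid generated by $S$; i.e., for all $a,b\in L$ and $\langle f,h\rangle\in S'$: $a\leq C_M(a)$; $a\leq b$ implies $C_M(a)\leq C_M(b)$; and $C_M(h(C_M(a)))\leq h(C_M(a))$.
   Context: An isotone Galois connection in $\mathbf{L}$ is a pair $\langle f,h\rangle$ of maps $L\to L$ with $f(a)\leq b$ iff $a\leq h(b)$; composition $\langle f_1,h_1\rangle\circ\langle f_2,h_2\rangle=\langle f_1f_2,h_2h_1\rangle$. An $L$-parameterization is a set $S$ of isotone Galois connections containing $\langle\mathrm{id},\mathrm{id}\rangle$. The monoid generated by $S$ is the set $S'$ of all finite compositions $\langle f_1,h_1\rangle\circ\cdots\circ\langle f_n,h_n\rangle$ of elements of $S$. For $a,b\in L$, $M\models a\Rightarrow b$ means: for all $m\in M$ and all $\langle f,h\rangle\in S'$, $f(a)\leq m$ implies $f(b)\leq m$. $C_M(a)=\bigvee\{b\in L;\ M\models a\Rightarrow b\}$. -}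

module Defs where

open import Level using (Level; suc; _⊔_)
open import Data.Product using (_×_; _,_; proj₁; proj₂)
open import Function using (id; _∘_)
open import Relation.Unary using (Pred)
open import Relation.Binary.Bundles using (Poset)

record CompleteLattice (ℓ : Level) : Set (suc ℓ) where
  field
    poset : Poset ℓ ℓ ℓ
  open Poset poset public
  field
    ⋁      : Pred Carrier ℓ → Carrier
    ⋁-ub   : (P : Pred Carrier ℓ) (x : Carrier) → P x → x ≤ ⋁ P
    ⋁-least : (P : Pred Carrier ℓ) (u : Carrier) →
              ((x : Carrier) → P x → x ≤ u) → ⋁ P ≤ u

module _ {ℓ : Level} (𝐋 : CompleteLattice ℓ) where
  open CompleteLattice 𝐋

  MapPair : Set ℓ
  MapPair = (Carrier → Carrier) × (Carrier → Carrier)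

  IsGalois : MapPair → Set ℓ
  IsGalois (f , h) = (a b : Carrier) → (f a ≤ b → a ≤ h b) × (a ≤ h b → f a ≤ b)

  idPair : MapPair
  idPair = (id , id)

  _⊚_ : MapPair → MapPair → MapPair
  (f₁ , h₁) ⊚ (f₂ , h₂) = (f₁ ∘ f₂ , h₂ ∘ h₁)

  record IsParameterization (S : Pred MapPair ℓ) : Set ℓ where
    field
      galois : (p : MapPair) → S p → IsGalois p
      hasId  : S idPair

  data Generated (S : Pred MapPair ℓ) : Pred MapPair ℓ where
    single : {p : MapPair} → S p → Generated S p
    cons   : {p q : MapPair} → S p → Generated S q → Generated S (p ⊚ q)

  Entails : Pred Carrier ℓ → Pred MapPair ℓ → Carrier → Carrier → Set ℓ
  Entails M S a b = (m : Carrier) → M m → (p : MapPair) → Generated S p →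
                    proj₁ p a ≤ m → proj₁ p b ≤ m

  C : Pred Carrier ℓ → Pred MapPair ℓ → Carrier → Carrier
  C M S a = ⋁ (Entails M S a)

-- M ⊨ a ⇒ b is a preorder containing ≥, and C_M(a) is the largest b with
-- M ⊨ a ⇒ b: since lower adjoints preserve joins, f(C_M a) ≤ m as soon as every
-- entailed f b is, so M ⊨ a ⇒ C_M(a). This gives extensivity and monotonicity. For the
-- third law, note that S' is closed under composition, so M ⊨ b ⇒ x implies
-- M ⊨ f b ⇒ f x; with c = C_M(a) and f(h c) ≤ c we get M ⊨ a ⇒ f x for every x
-- entailed by h c, hence f x ≤ c, i.e. x ≤ h c.
module Submission where

open import Defs
open import Level using (Level)
open import Data.Product using (_×_; _,_; proj₁; proj₂)
open import Relation.Unary using (Pred)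

module GaloisConnection {ℓ : Level} (𝐋 : CompleteLattice ℓ) where
  open CompleteLattice 𝐋

  ⊚-galois : {p q : MapPair 𝐋} → IsGalois 𝐋 p → IsGalois 𝐋 q → IsGalois 𝐋 (_⊚_ 𝐋 p q)
  ⊚-galois {f₁ , h₁} {f₂ , h₂} g₁ g₂ a b =
    (λ f₁f₂a≤b → proj₁ (g₂ a (h₁ b)) (proj₁ (g₁ (f₂ a) b) f₁f₂a≤b)) ,
    (λ a≤h₂h₁b → proj₂ (g₁ (f₂ a) b) (proj₂ (g₂ a (h₁ b)) a≤h₂h₁b))

  module _ {f h : Carrier → Carrier} (g : IsGalois 𝐋 (f , h)) where

    unit : (a : Carrier) → a ≤ h (f a)
    unit a = proj₁ (g a (f a)) refl

    counit : (b : Carrier) → f (h b) ≤ b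
    counit b = proj₂ (g (h b) b) refl

    lower-mono : {a b : Carrier} → a ≤ b → f a ≤ f b
    lower-mono {a} {b} a≤b = proj₂ (g a (f b)) (trans a≤b (unit b))

    lower-⋁-least : (P : Pred Carrier ℓ) (m : Carrier) →
                    ((x : Carrier) → P x → f x ≤ m) → f (⋁ P) ≤ m
    lower-⋁-least P m bound =
      proj₂ (g (⋁ P) m) (⋁-least P (h m) λ x Px → proj₁ (g x m) (bound x Px))

module _ {ℓ : Level} {𝐋 : CompleteLattice ℓ} {S : Pred (MapPair 𝐋) ℓ} where

  Generated-⊚ : {p q : MapPair 𝐋} → Generated 𝐋 S p → Generated 𝐋 S q →
                Generated 𝐋 S (_⊚_ 𝐋 p q)
  Generated-⊚ (single s)   gq = cons s gq
  Generated-⊚ (cons s gp) gq = cons s (Generated-⊚ gp gq)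

  Generated-galois : ((p : MapPair 𝐋) → S p → IsGalois 𝐋 p) →
                     {p : MapPair 𝐋} → Generated 𝐋 S p → IsGalois 𝐋 p
  Generated-galois galois (single s)  = galois _ s
  Generated-galois galois (cons s gq) =
    GaloisConnection.⊚-galois 𝐋 (galois _ s) (Generated-galois galois gq)

module Closure {ℓ : Level} (𝐋 : CompleteLattice ℓ) (M : Pred (CompleteLattice.Carrier 𝐋) ℓ)
               (S : Pred (MapPair 𝐋) ℓ) (galois : (p : MapPair 𝐋) → S p → IsGalois 𝐋 p) where
  open CompleteLattice 𝐋
  open GaloisConnection 𝐋

  _⇒_ : Carrier → Carrier → Set ℓ
  _⇒_ = Entails 𝐋 M S

  ⇒-≥ : {a b : Carrier} → b ≤ a → a ⇒ b
  ⇒-≥ b≤a m _ p gp fa≤m = trans (lower-mono (Generated-galois galois gp) b≤a) fa≤m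

  ⇒-trans : {a b c : Carrier} → a ⇒ b → b ⇒ c → a ⇒ c
  ⇒-trans a⇒b b⇒c m Mm p gp fa≤m = b⇒c m Mm p gp (a⇒b m Mm p gp fa≤m)

  ⇒-lower : {f h : Carrier → Carrier} → Generated 𝐋 S (f , h) →
            {b x : Carrier} → b ⇒ x → f b ⇒ f x
  ⇒-lower {f} {h} gp b⇒x m Mm q gq = b⇒x m Mm (_⊚_ 𝐋 q (f , h)) (Generated-⊚ gq gp)

  ⇒-C-ub : {a b : Carrier} → a ⇒ b → b ≤ C 𝐋 M S a
  ⇒-C-ub {a} {b} = ⋁-ub (Entails 𝐋 M S a) b

  ⇒-C : (a : Carrier) → a ⇒ C 𝐋 M S a
  ⇒-C a m Mm q gq qa≤m =
    lower-⋁-least (Generated-galois galois gq) (a ⇒_) m λ x a⇒x → a⇒x m Mm q gq qa≤m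

  C-extensive : (a : Carrier) → a ≤ C 𝐋 M S a
  C-extensive a = ⇒-C-ub (⇒-≥ refl)

  C-mono : (a b : Carrier) → a ≤ b → C 𝐋 M S a ≤ C 𝐋 M S b
  C-mono a b a≤b = ⋁-least (a ⇒_) (C 𝐋 M S b) λ x a⇒x → ⇒-C-ub (⇒-trans (⇒-≥ a≤b) a⇒x)

  C-upper-closed : (a : Carrier) (p : MapPair 𝐋) → Generated 𝐋 S p →
                   C 𝐋 M S (proj₂ p (C 𝐋 M S a)) ≤ proj₂ p (C 𝐋 M S a)
  C-upper-closed a (f , h) gp = ⋁-least (h c ⇒_) (h c) λ x hc⇒x →
    proj₁ (g x c) (⇒-C-ub (⇒-trans a⇒fhc (⇒-lower gp hc⇒x)))
    where
    c = C 𝐋 M S a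
    g = Generated-galois galois gp
    a⇒fhc : a ⇒ f (h c)
    a⇒fhc = ⇒-trans (⇒-C a) (⇒-≥ (counit g c))

theorem28 : {ℓ : Level} (𝐋 : CompleteLattice ℓ) (M : Pred (CompleteLattice.Carrier 𝐋) ℓ)
            (S : Pred (MapPair 𝐋) ℓ) → IsParameterization 𝐋 S →
            let open CompleteLattice 𝐋 in
            ((a : Carrier) → a ≤ C 𝐋 M S a)
            × ((a b : Carrier) → a ≤ b → C 𝐋 M S a ≤ C 𝐋 M S b)
            × ((a : Carrier) (p : MapPair 𝐋) → Generated 𝐋 S p →
                 C 𝐋 M S (proj₂ p (C 𝐋 M S a)) ≤ proj₂ p (C 𝐋 M S a))
theorem28 𝐋 M S param = C-extensive , C-mono , C-upper-closed
  where open Closure 𝐋 M S (IsParameterization.galois param)
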